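{- Let $m$ be an odd positive integer and let $a,d_1,d_2\in\mathbb{Z}/m\mathbb{Z}$ be such that $d_1$, $d_2$ and $d_2-d_1$ are all invertible. Then the arithmetic triangle $\mathrm{AT}(a,d_1,d_2,n)$ is balanced for every non-negative integer $n$ with $n\equiv 0$ or $n\equiv -1\pmod m$.
   Context: The arithmetic triangle $\mathrm{AT}(a,d_1,d_2,n)$ is the multiset $(a+id_2+jd_1)_{(i,j)}$ of elements of $\mathbb{Z}/m\mathbb{Z}$ indexed by pairs of non-negative integers with $i+j<n$. A finite multiset of $\mathbb{Z}/m\mathbb{Z}$ is balanced if every element of $\mathbb{Z}/m\mathbb{Z}$ occurs in it with the same multiplicity. -}

module Defs where

open import Data.Nat using (ℕ; zero; suc; _+_; _*_; _∸_; _<_; NonZero)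
open import Data.Nat.DivMod using (_%_)
open import Data.Fin using (Fin; toℕ)
open import Data.Bool using (Bool; true; false; if_then_else_)
open import Data.Fin.Properties using (_≟_)
open import Data.Product using (∃; _×_)
open import Relation.Binary.PropositionalEquality using (_≡_)
open import Relation.Nullary.Decidable using (⌊_⌋)

ℤmod : ℕ → Set
ℤmod m = Fin m

module _ (m : ℕ) .{{_ : NonZero m}} where

  [_] : ℕ → Fin m
  [ k ] = Data.Fin.fromℕ< (Data.Nat.DivMod.m%n<n k m)

  _⊕_ : Fin m → Fin m → Fin m
  x ⊕ y = [ toℕ x + toℕ y ]

  _⊗_ : Fin m → Fin m → Fin m
  x ⊗ y = [ toℕ x * toℕ y ]

  ⊖_ : Fin m → Fin m
  ⊖ x = [ m ∸ toℕ x ]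

  _⊝_ : Fin m → Fin m → Fin m
  x ⊝ y = x ⊕ (⊖ y)

  _·_ : ℕ → Fin m → Fin m
  k · x = [ k * toℕ x ]

  Invertible : Fin m → Set
  Invertible x = ∃ λ y → x ⊗ y ≡ [ 1 ]

  ATentry : Fin m → Fin m → Fin m → ℕ → ℕ → Fin m
  ATentry a d₁ d₂ i j = (a ⊕ (i · d₂)) ⊕ (j · d₁)

  -- multiplicity of x in the multiset AT(a,d₁,d₂,n):
  -- number of pairs (i,j) of naturals with i + j < n and entry ≡ x.
  -- countRow r i : number of j < r with entry (i,j) = x
  private
    countRow : Fin m → Fin m → Fin m → Fin m → ℕ → ℕ → ℕ
    countRow a d₁ d₂ x i zero = 0
    countRow a d₁ d₂ x i (suc r) =
      (if ⌊ ATentry a d₁ d₂ i r ≟ x ⌋ then 1 else 0) + countRow a d₁ d₂ x i r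

    -- rows i < k, row i has (n ∸ i) entries (j < n - i ⇔ i + j < n)
    countRows : Fin m → Fin m → Fin m → Fin m → ℕ → ℕ → ℕ
    countRows a d₁ d₂ x n zero = 0
    countRows a d₁ d₂ x n (suc k) =
      countRow a d₁ d₂ x k (n ∸ k) + countRows a d₁ d₂ x n k

  multiplicity : Fin m → Fin m → Fin m → ℕ → Fin m → ℕ
  multiplicity a d₁ d₂ n x = countRows a d₁ d₂ x n n

  Balanced : (Fin m → ℕ) → Set
  Balanced μ = ∀ x y → μ x ≡ μ y

-- The multiplicity of x is the number of zeros in the triangle c + i d₂ + j d₁ with c = a - x, so
-- it suffices that this count does not depend on c. Replacing c by c + d₁ shifts every row by one
-- step: the column c + i d₂ (i < n) leaves, and the hypotenuse c + i d₂ + (n - i) d₁, which is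
-- (c + n d₁) + i (d₂ - d₁), enters. Both are arithmetic progressions with unit steps, so each meets
-- 0 exactly once in every m consecutive terms. If m ∣ n, both thus contain n / m zeros; if
-- m ∣ n + 1, the same holds after extending both by their term i = n, which is c + n d₂ in either
-- case. So the count is invariant under c ↦ c + d₁, hence constant because d₁ is a unit.
module Submission where

open import Defs
open import Data.Bool.Base using (if_then_else_)
open import Data.Fin.Base using (Fin; toℕ)
open import Data.Fin.Properties using (toℕ<n; toℕ-fromℕ<; toℕ-injective)
open import Data.Nat.Base using (ℕ; zero; suc; _+_; _*_; _∸_; _<_; _≤_; s≤s⁻¹; NonZero)
open import Data.Nat.DivMod
  using (_%_; m%n<n; m<n⇒m%n≡m; m%n%n≡m%n; %-distribˡ-+; %-distribˡ-*; [m+n]%n≡m%n)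
open import Data.Nat.Divisibility using (divides; m%n≡0⇒n∣m)
open import Data.Nat.Properties
  using (_≟_; ≤-refl; <⇒≤; ≤∧≢⇒<; <-irrefl; n<1+n; m<n⇒m<1+n; +-comm; +-assoc; +-identityʳ; +-suc;
         *-comm; *-assoc; *-identityʳ; +-cancelˡ-≡; +-cancelʳ-≡; m∸n+n≡m; n∸n≡0)
open import Data.Nat.Tactic.RingSolver using (solve-∀)
open import Data.Product.Base using (∃; _,_; proj₂)
open import Data.Sum.Base using (_⊎_; inj₁; inj₂)
open import Function.Base using (_∘_)
open import Function.Bundles using (_⇔_; mk⇔; Equivalence)
open import Relation.Binary.Bundles using (Setoid)
import Relation.Binary.Reasoning.Setoid
open import Relation.Binary.PropositionalEquality
  using (_≡_; _≢_; refl; sym; trans; cong; cong₂; module ≡-Reasoning)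
open import Relation.Nullary.Decidable
  using (Dec; yes; no; ⌊_⌋; map′; isYes≗does; dec-true; dec-false; does-⇔)
open import Relation.Nullary.Negation using (¬_)

private
  variable
    P Q : Set

𝟙 : Dec P → ℕ
𝟙 p? = if ⌊ p? ⌋ then 1 else 0

𝟙-yes : (p? : Dec P) → P → 𝟙 p? ≡ 1
𝟙-yes p? p = cong (if_then 1 else 0) (trans (isYes≗does p?) (dec-true p? p))

𝟙-no : (p? : Dec P) → ¬ P → 𝟙 p? ≡ 0
𝟙-no p? ¬p = cong (if_then 1 else 0) (trans (isYes≗does p?) (dec-false p? ¬p))

𝟙-⇔ : P ⇔ Q → (p? : Dec P) (q? : Dec Q) → 𝟙 p? ≡ 𝟙 q?
𝟙-⇔ P⇔Q p? q? = cong (if_then 1 else 0)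
  (trans (isYes≗does p?) (trans (does-⇔ P⇔Q p? q?) (sym (isYes≗does q?))))

∑< : ℕ → (ℕ → ℕ) → ℕ
∑< zero    f = 0
∑< (suc n) f = f n + ∑< n f

syntax ∑< n (λ i → e) = ∑[ i < n ] e

∑-cong : ∀ n {f g : ℕ → ℕ} → (∀ {i} → i < n → f i ≡ g i) → ∑< n f ≡ ∑< n g
∑-cong zero    f≗g = refl
∑-cong (suc n) f≗g = cong₂ _+_ (f≗g (n<1+n n)) (∑-cong n (f≗g ∘ m<n⇒m<1+n))

∑-distrib-+ : ∀ n (f g : ℕ → ℕ) → ∑[ i < n ] (f i + g i) ≡ ∑< n f + ∑< n g
∑-distrib-+ zero    f g = refl
∑-distrib-+ (suc n) f g = begin
  (f n + g n) + ∑[ i < n ] (f i + g i) ≡⟨ cong (f n + g n +_) (∑-distrib-+ n f g) ⟩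
  (f n + g n) + (∑< n f + ∑< n g)      ≡⟨ interchange (f n) (g n) (∑< n f) (∑< n g) ⟩
  (f n + ∑< n f) + (g n + ∑< n g)      ∎
  where
  open ≡-Reasoning
  interchange : ∀ a b c d → (a + b) + (c + d) ≡ (a + c) + (b + d)
  interchange = solve-∀

∑-shift : ∀ n (f : ℕ → ℕ) → ∑[ j < n ] f (suc j) + f 0 ≡ ∑< n f + f n
∑-shift zero    f = refl
∑-shift (suc n) f = begin
  (f (suc n) + ∑[ j < n ] f (suc j)) + f 0 ≡⟨ +-assoc (f (suc n)) _ _ ⟩
  f (suc n) + (∑[ j < n ] f (suc j) + f 0) ≡⟨ cong (f (suc n) +_) (∑-shift n f) ⟩
  f (suc n) + (∑< n f + f n)               ≡⟨ +-comm (f (suc n)) _ ⟩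
  (∑< n f + f n) + f (suc n)               ≡⟨ cong (_+ f (suc n)) (+-comm (∑< n f) (f n)) ⟩
  (f n + ∑< n f) + f (suc n)               ∎
  where open ≡-Reasoning

∑-+ : ∀ a c (f : ℕ → ℕ) → ∑< (a + c) f ≡ ∑[ i < c ] f (a + i) + ∑< a f
∑-+ a zero    f = cong (λ k → ∑< k f) (+-identityʳ a)
∑-+ a (suc c) f = begin
  ∑< (a + suc c) f                          ≡⟨ cong (λ k → ∑< k f) (+-suc a c) ⟩
  f (a + c) + ∑< (a + c) f                  ≡⟨ cong (f (a + c) +_) (∑-+ a c f) ⟩
  f (a + c) + (∑[ i < c ] f (a + i) + ∑< a f) ≡⟨ +-assoc (f (a + c)) _ _ ⟨
  ∑[ i < suc c ] f (a + i) + ∑< a f          ∎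
  where open ≡-Reasoning

∑-periodic : ∀ m k (f : ℕ → ℕ) → (∀ s → ∑[ i < m ] f (s + i) ≡ k) → ∀ q → ∑< (q * m) f ≡ q * k
∑-periodic m k f window zero    = refl
∑-periodic m k f window (suc q) = begin
  ∑< (m + q * m) f                          ≡⟨ cong (λ l → ∑< l f) (+-comm m (q * m)) ⟩
  ∑< (q * m + m) f                          ≡⟨ ∑-+ (q * m) m f ⟩
  ∑[ i < m ] f (q * m + i) + ∑< (q * m) f   ≡⟨ cong₂ _+_ (window (q * m)) (∑-periodic m k f window q) ⟩
  k + q * k                                 ∎
  where open ≡-Reasoning

∑-zero : ∀ n (f : ℕ → ℕ) → (∀ {i} → i < n → f i ≡ 0) → ∑< n f ≡ 0
∑-zero zero    f f≗0 = refl
∑-zero (suc n) f f≗0 = cong₂ _+_ (f≗0 (n<1+n n)) (∑-zero n f (f≗0 ∘ m<n⇒m<1+n))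

∑-single : ∀ n (f : ℕ → ℕ) w → w < n → (∀ {i} → i < n → i ≢ w → f i ≡ 0) → ∑< n f ≡ f w
∑-single (suc n) f w w<1+n f≗0 with n ≟ w
... | yes refl = trans (cong (f n +_) (∑-zero n f λ i<n →
                         f≗0 (m<n⇒m<1+n i<n) λ { refl → <-irrefl refl i<n }))
                       (+-identityʳ (f n))
... | no n≢w   = cong₂ _+_ (f≗0 (n<1+n n) n≢w)
                           (∑-single n f w (≤∧≢⇒< (s≤s⁻¹ w<1+n) (n≢w ∘ sym)) (f≗0 ∘ m<n⇒m<1+n))

triangle : ℕ → (ℕ → ℕ → ℕ) → ℕ
triangle n f = ∑[ i < n ] ∑[ j < n ∸ i ] f i j

triangle-cong : ∀ n {f g : ℕ → ℕ → ℕ} → (∀ i j → f i j ≡ g i j) → triangle n f ≡ triangle n g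
triangle-cong n f≗g = ∑-cong n λ {i} _ → ∑-cong (n ∸ i) λ {j} _ → f≗g i j

triangle-shift : ∀ n (f : ℕ → ℕ → ℕ) →
  triangle n (λ i j → f i (suc j)) + ∑[ i < n ] f i 0 ≡ triangle n f + ∑[ i < n ] f i (n ∸ i)
triangle-shift n f = begin
  triangle n (λ i j → f i (suc j)) + ∑[ i < n ] f i 0
    ≡⟨ ∑-distrib-+ n (λ i → ∑[ j < n ∸ i ] f i (suc j)) (λ i → f i 0) ⟨
  ∑[ i < n ] (∑[ j < n ∸ i ] f i (suc j) + f i 0)
    ≡⟨ ∑-cong n (λ {i} _ → ∑-shift (n ∸ i) (f i)) ⟩
  ∑[ i < n ] (∑[ j < n ∸ i ] f i j + f i (n ∸ i))
    ≡⟨ ∑-distrib-+ n (λ i → ∑[ j < n ∸ i ] f i j) (λ i → f i (n ∸ i)) ⟩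
  triangle n f + ∑[ i < n ] f i (n ∸ i) ∎
  where open ≡-Reasoning

module Modulo (m : ℕ) .{{_ : NonZero m}} where

  infix 4 _≈_ _≈?_

  -- A record rather than a % m ≡ b % m, so that a and b can be inferred from a ≈ b.
  record _≈_ (a b : ℕ) : Set where
    constructor mk≈
    field %-≡ : a % m ≡ b % m

  open _≈_

  ≈-refl : ∀ {a} → a ≈ a
  ≈-refl = mk≈ refl

  ≈-sym : ∀ {a b} → a ≈ b → b ≈ a
  ≈-sym (mk≈ p) = mk≈ (sym p)

  ≈-trans : ∀ {a b c} → a ≈ b → b ≈ c → a ≈ c
  ≈-trans (mk≈ p) (mk≈ q) = mk≈ (trans p q)

  ≡⇒≈ : ∀ {a b} → a ≡ b → a ≈ b
  ≡⇒≈ refl = ≈-refl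

  ≈-setoid : Setoid _ _
  ≈-setoid = record
    { Carrier = ℕ
    ; _≈_ = _≈_
    ; isEquivalence = record { refl = ≈-refl ; sym = ≈-sym ; trans = ≈-trans }
    }

  module ≈-Reasoning = Relation.Binary.Reasoning.Setoid ≈-setoid

  _≈?_ : ∀ a b → Dec (a ≈ b)
  a ≈? b = map′ mk≈ %-≡ (a % m ≟ b % m)

  %-≈ : ∀ a → a % m ≈ a
  %-≈ a = mk≈ (m%n%n≡m%n a m)

  +-m : ∀ a → a + m ≈ a
  +-m a = mk≈ ([m+n]%n≡m%n a m)

  m≈0 : m ≈ 0
  m≈0 = +-m 0

  +-cong : ∀ {a b c d} → a ≈ b → c ≈ d → a + c ≈ b + d
  +-cong {a} {b} {c} {d} (mk≈ p) (mk≈ q) = mk≈ (begin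
    (a + c) % m             ≡⟨ %-distribˡ-+ a c m ⟩
    (a % m + c % m) % m     ≡⟨ cong₂ (λ x y → (x + y) % m) p q ⟩
    (b % m + d % m) % m     ≡⟨ %-distribˡ-+ b d m ⟨
    (b + d) % m             ∎)
    where open ≡-Reasoning

  +-congˡ : ∀ a {b c} → b ≈ c → a + b ≈ a + c
  +-congˡ a = +-cong (≈-refl {a})

  +-congʳ : ∀ c {a b} → a ≈ b → a + c ≈ b + c
  +-congʳ c a≈b = +-cong a≈b (≈-refl {c})

  *-cong : ∀ {a b c d} → a ≈ b → c ≈ d → a * c ≈ b * d
  *-cong {a} {b} {c} {d} (mk≈ p) (mk≈ q) = mk≈ (begin
    (a * c) % m             ≡⟨ %-distribˡ-* a c m ⟩
    (a % m * (c % m)) % m   ≡⟨ cong₂ (λ x y → (x * y) % m) p q ⟩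
    (b % m * (d % m)) % m   ≡⟨ %-distribˡ-* b d m ⟨
    (b * d) % m             ∎)
    where open ≡-Reasoning

  *-congˡ : ∀ a {b c} → b ≈ c → a * b ≈ a * c
  *-congˡ a = *-cong (≈-refl {a})

  *-congʳ : ∀ c {a b} → a ≈ b → a * c ≈ b * c
  *-congʳ c a≈b = *-cong a≈b (≈-refl {c})

  <m-≈⇒≡ : ∀ {a b} → a < m → b < m → a ≈ b → a ≡ b
  <m-≈⇒≡ a<m b<m (mk≈ p) = trans (sym (m<n⇒m%n≡m a<m)) (trans p (m<n⇒m%n≡m b<m))

  -_ : ℕ → ℕ
  - a = m ∸ a % m

  +-inverseʳ : ∀ a → a + - a ≈ 0
  +-inverseʳ a = begin
    a + (m ∸ a % m)     ≈⟨ +-cong (≈-sym (%-≈ a)) ≈-refl ⟩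
    a % m + (m ∸ a % m) ≡⟨ +-comm (a % m) _ ⟩
    (m ∸ a % m) + a % m ≡⟨ m∸n+n≡m (<⇒≤ (m%n<n a m)) ⟩
    m                   ≈⟨ m≈0 ⟩
    0                   ∎
    where open ≈-Reasoning

  +-cancelʳ : ∀ {a b} c → a + c ≈ b + c → a ≈ b
  +-cancelʳ {a} {b} c a+c≈b+c = begin
    a                 ≡⟨ +-identityʳ a ⟨
    a + 0             ≈⟨ +-cong ≈-refl (+-inverseʳ c) ⟨
    a + (c + - c)     ≡⟨ +-assoc a c (- c) ⟨
    a + c + - c       ≈⟨ +-cong a+c≈b+c ≈-refl ⟩
    b + c + - c       ≡⟨ +-assoc b c (- c) ⟩
    b + (c + - c)     ≈⟨ +-cong ≈-refl (+-inverseʳ c) ⟩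
    b + 0             ≡⟨ +-identityʳ b ⟩
    b                 ∎
    where open ≈-Reasoning

  +-cancelˡ : ∀ {a b} c → c + a ≈ c + b → a ≈ b
  +-cancelˡ {a} {b} c c+a≈c+b = +-cancelʳ c
    (≈-trans (≡⇒≈ (+-comm a c)) (≈-trans c+a≈c+b (≡⇒≈ (+-comm c b))))

  ≈⇔-≈0 : ∀ a b → a ≈ b ⇔ a + - b ≈ 0
  ≈⇔-≈0 a b = mk⇔ (λ a≈b → ≈-trans (+-cong a≈b ≈-refl) (+-inverseʳ b))
                  (λ a-b≈0 → +-cancelʳ (- b) (≈-trans a-b≈0 (≈-sym (+-inverseʳ b))))

  *-cancelʳ-unit : ∀ {a b u e} → u * e ≈ 1 → a * u ≈ b * u → a ≈ b
  *-cancelʳ-unit {a} {b} {u} {e} ue≈1 au≈bu = begin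
    a             ≡⟨ *-identityʳ a ⟨
    a * 1         ≈⟨ *-congˡ a ue≈1 ⟨
    a * (u * e)   ≡⟨ *-assoc a u e ⟨
    a * u * e     ≈⟨ *-congʳ e au≈bu ⟩
    b * u * e     ≡⟨ *-assoc b u e ⟩
    b * (u * e)   ≈⟨ *-congˡ b ue≈1 ⟩
    b * 1         ≡⟨ *-identityʳ b ⟩
    b             ∎
    where open ≈-Reasoning

  χ : ℕ → ℕ
  χ a = 𝟙 (a ≈? 0)

  χ-cong : ∀ {a b} → a ≈ b → χ a ≡ χ b
  χ-cong a≈b = 𝟙-⇔ (mk⇔ (≈-trans (≈-sym a≈b)) (≈-trans a≈b)) _ _

  ∑-χ-window : ∀ {u e} → u * e ≈ 1 → ∀ b → ∑[ i < m ] χ (b + i * u) ≡ 1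
  ∑-χ-window {u} {e} ue≈1 b =
    trans (∑-single m (λ i → χ (b + i * u)) w (m%n<n _ m) not-w) (𝟙-yes _ hit)
    where
    w : ℕ
    w = (- b * e) % m

    hit : b + w * u ≈ 0
    hit = begin
      b + w * u             ≈⟨ +-congˡ b (*-congʳ u (%-≈ (- b * e))) ⟩
      b + - b * e * u       ≡⟨ cong (b +_) (*-assoc (- b) e u) ⟩
      b + - b * (e * u)     ≡⟨ cong (λ x → b + - b * x) (*-comm e u) ⟩
      b + - b * (u * e)     ≈⟨ +-congˡ b (*-congˡ (- b) ue≈1) ⟩
      b + - b * 1           ≡⟨ cong (b +_) (*-identityʳ (- b)) ⟩
      b + - b               ≈⟨ +-inverseʳ b ⟩
      0                     ∎
      where open ≈-Reasoning

    not-w : ∀ {i} → i < m → i ≢ w → χ (b + i * u) ≡ 0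
    not-w {i} i<m i≢w = 𝟙-no _ λ hitᵢ →
      i≢w (<m-≈⇒≡ i<m (m%n<n _ m) (*-cancelʳ-unit ue≈1 (+-cancelˡ b (≈-trans hitᵢ (≈-sym hit)))))

  ∑-χ-progression : ∀ {u e} → u * e ≈ 1 → ∀ b q → ∑[ i < q * m ] χ (b + i * u) ≡ q
  ∑-χ-progression {u} ue≈1 b q =
    trans (∑-periodic m 1 (λ i → χ (b + i * u)) window q) (*-identityʳ q)
    where
    window : ∀ s → ∑[ i < m ] χ (b + (s + i) * u) ≡ 1
    window s = trans (∑-cong m λ {i} _ → cong χ (regroup b s i u)) (∑-χ-window ue≈1 (b + s * u))
      where
      regroup : ∀ b s i u → b + (s + i) * u ≡ b + s * u + i * u
      regroup = solve-∀

  ∑-periods-agree : ∀ n {f g : ℕ → ℕ} → (∀ q → ∑< (q * m) f ≡ q) → (∀ q → ∑< (q * m) g ≡ q) →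
    f n ≡ g n → n % m ≡ 0 ⊎ (n + 1) % m ≡ 0 → ∑< n f ≡ ∑< n g
  ∑-periods-agree n countF countG fn≡gn (inj₁ m∣n) with m%n≡0⇒n∣m n m m∣n
  ... | divides q refl = trans (countF q) (sym (countG q))
  ∑-periods-agree n {f} {g} countF countG fn≡gn (inj₂ m∣n+1) with m%n≡0⇒n∣m (n + 1) m m∣n+1
  ... | divides q n+1≡qm = +-cancelˡ-≡ (f n) _ _ (begin
    f n + ∑< n f    ≡⟨ cong (λ k → ∑< k f) 1+n≡qm ⟩
    ∑< (q * m) f    ≡⟨ countF q ⟩
    q               ≡⟨ countG q ⟨
    ∑< (q * m) g    ≡⟨ cong (λ k → ∑< k g) 1+n≡qm ⟨
    g n + ∑< n g    ≡⟨ cong (_+ ∑< n g) fn≡gn ⟨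
    f n + ∑< n g    ∎)
    where
    open ≡-Reasoning
    1+n≡qm : suc n ≡ q * m
    1+n≡qm = trans (+-comm 1 n) n+1≡qm

  module _ {D₁ D₂ W : ℕ} (W+D₁≈D₂ : W + D₁ ≈ D₂) where

    hypotenuse-progression : ∀ c {i n} → i ≤ n → c + i * D₂ + (n ∸ i) * D₁ ≈ c + n * D₁ + i * W
    hypotenuse-progression c {i} {n} i≤n = begin
      c + i * D₂ + (n ∸ i) * D₁        ≈⟨ +-congʳ ((n ∸ i) * D₁) (+-congˡ c (*-congˡ i W+D₁≈D₂)) ⟨
      c + i * (W + D₁) + (n ∸ i) * D₁  ≡⟨ regroup c i (n ∸ i) D₁ W ⟩
      c + ((n ∸ i) + i) * D₁ + i * W   ≡⟨ cong (λ k → c + k * D₁ + i * W) (m∸n+n≡m i≤n) ⟩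
      c + n * D₁ + i * W               ∎
      where
      open ≈-Reasoning
      regroup : ∀ c i k D₁ W → c + i * (W + D₁) + k * D₁ ≡ c + (k + i) * D₁ + i * W
      regroup = solve-∀

    column≡hypotenuse : ∀ {e₂ e₃} → D₂ * e₂ ≈ 1 → W * e₃ ≈ 1 → ∀ n → n % m ≡ 0 ⊎ (n + 1) % m ≡ 0 → ∀ c →
      ∑[ i < n ] χ (c + i * D₂ + 0 * D₁) ≡ ∑[ i < n ] χ (c + i * D₂ + (n ∸ i) * D₁)
    column≡hypotenuse D₂-unit W-unit n n≡0∨-1 c = begin
      ∑[ i < n ] χ (c + i * D₂ + 0 * D₁)         ≡⟨ ∑-cong n (λ _ → cong χ (+-identityʳ _)) ⟩
      ∑[ i < n ] χ (c + i * D₂)                  ≡⟨ ∑-periods-agree n (∑-χ-progression D₂-unit c)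
                                                     (∑-χ-progression W-unit (c + n * D₁)) last n≡0∨-1 ⟩
      ∑[ i < n ] χ (c + n * D₁ + i * W)          ≡⟨ ∑-cong n (χ-cong ∘ hypotenuse-progression c ∘ <⇒≤) ⟨
      ∑[ i < n ] χ (c + i * D₂ + (n ∸ i) * D₁)   ∎
      where
      open ≡-Reasoning
      last : χ (c + n * D₂) ≡ χ (c + n * D₁ + n * W)
      last = χ-cong (≈-trans (≡⇒≈ no-hypotenuse-offset) (hypotenuse-progression c {n} {n} ≤-refl))
        where
        no-hypotenuse-offset : c + n * D₂ ≡ c + n * D₂ + (n ∸ n) * D₁
        no-hypotenuse-offset = sym (trans (cong (λ k → c + n * D₂ + k * D₁) (n∸n≡0 n)) (+-identityʳ _))

  translation-invariant⇒constant : ∀ {D e} (g : ℕ → ℕ) → D * e ≈ 1 →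
    (∀ {c c'} → c ≈ c' → g c ≡ g c') → (∀ c → g (c + D) ≡ g c) → ∀ c c' → g c ≡ g c'
  translation-invariant⇒constant {D} {e} g De≈1 g-cong g-+D c c' =
    trans (sym (g-+tD t c)) (g-cong c+tD≈c')
    where
    g-+tD : ∀ t c → g (c + t * D) ≡ g c
    g-+tD zero    c = cong g (+-identityʳ c)
    g-+tD (suc t) c = trans (cong g (sym (+-assoc c D (t * D)))) (trans (g-+tD t (c + D)) (g-+D c))

    t : ℕ
    t = (c' + - c) * e

    c+tD≈c' : c + t * D ≈ c'
    c+tD≈c' = begin
      c + (c' + - c) * e * D     ≡⟨ cong (c +_) (*-assoc (c' + - c) e D) ⟩
      c + (c' + - c) * (e * D)   ≡⟨ cong (λ k → c + (c' + - c) * k) (*-comm e D) ⟩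
      c + (c' + - c) * (D * e)   ≈⟨ +-congˡ c (*-congˡ (c' + - c) De≈1) ⟩
      c + (c' + - c) * 1         ≡⟨ regroup c c' (- c) ⟩
      c' + (c + - c)             ≈⟨ +-congˡ c' (+-inverseʳ c) ⟩
      c' + 0                     ≡⟨ +-identityʳ c' ⟩
      c'                         ∎
      where
      open ≈-Reasoning
      regroup : ∀ c c' d → c + (c' + d) * 1 ≡ c' + (c + d)
      regroup = solve-∀

  zeroCount : (D₁ D₂ n c : ℕ) → ℕ
  zeroCount D₁ D₂ n c = triangle n (λ i j → χ (c + i * D₂ + j * D₁))

  zeroCount-cong : ∀ D₁ D₂ n {c c'} → c ≈ c' → zeroCount D₁ D₂ n c ≡ zeroCount D₁ D₂ n c'
  zeroCount-cong D₁ D₂ n c≈c' =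
    triangle-cong n λ i j → χ-cong (+-congʳ (j * D₁) (+-congʳ (i * D₂) c≈c'))

  zeroCount-+D₁ : ∀ D₁ D₂ n c →
    ∑[ i < n ] χ (c + i * D₂ + 0 * D₁) ≡ ∑[ i < n ] χ (c + i * D₂ + (n ∸ i) * D₁) →
    zeroCount D₁ D₂ n (c + D₁) ≡ zeroCount D₁ D₂ n c
  zeroCount-+D₁ D₁ D₂ n c column≡hyp = +-cancelʳ-≡ column _ _ (begin
    zeroCount D₁ D₂ n (c + D₁) + column
      ≡⟨ cong (_+ column) (triangle-cong n λ i j → cong χ (regroup c D₁ D₂ i j)) ⟩
    triangle n (λ i j → f i (suc j)) + column  ≡⟨ triangle-shift n f ⟩
    zeroCount D₁ D₂ n c + hypotenuse           ≡⟨ cong (zeroCount D₁ D₂ n c +_) column≡hyp ⟨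
    zeroCount D₁ D₂ n c + column               ∎)
    where
    open ≡-Reasoning
    f : ℕ → ℕ → ℕ
    f i j = χ (c + i * D₂ + j * D₁)
    column hypotenuse : ℕ
    column = ∑[ i < n ] f i 0
    hypotenuse = ∑[ i < n ] f i (n ∸ i)
    regroup : ∀ c D₁ D₂ i j → c + D₁ + i * D₂ + j * D₁ ≡ c + i * D₂ + suc j * D₁
    regroup = solve-∀

  toℕ-[] : ∀ k → toℕ ([_] m k) ≈ k
  toℕ-[] k = mk≈ (trans (cong (_% m) (toℕ-fromℕ< (m%n<n k m))) (m%n%n≡m%n k m))

  toℕ-≈⇒≡ : ∀ (x y : Fin m) → toℕ x ≈ toℕ y → x ≡ y
  toℕ-≈⇒≡ x y = toℕ-injective ∘ <m-≈⇒≡ (toℕ<n x) (toℕ<n y)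

  toℕ-ATentry : ∀ a d₁ d₂ i j → toℕ (ATentry m a d₁ d₂ i j) ≈ toℕ a + i * toℕ d₂ + j * toℕ d₁
  toℕ-ATentry a d₁ d₂ i j = ≈-trans (toℕ-[] _)
    (+-cong (≈-trans (toℕ-[] _) (+-congˡ (toℕ a) (toℕ-[] _))) (toℕ-[] _))

  toℕ-⊝ : ∀ x y → toℕ (_⊝_ m x y) + toℕ y ≈ toℕ x
  toℕ-⊝ x y = begin
    toℕ (_⊝_ m x y) + toℕ y          ≈⟨ +-congʳ (toℕ y) (toℕ-[] _) ⟩
    toℕ x + toℕ (⊖_ m y) + toℕ y     ≈⟨ +-congʳ (toℕ y) (+-congˡ (toℕ x) (toℕ-[] _)) ⟩
    toℕ x + (m ∸ toℕ y) + toℕ y      ≡⟨ +-assoc (toℕ x) _ _ ⟩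
    toℕ x + ((m ∸ toℕ y) + toℕ y)    ≡⟨ cong (toℕ x +_) (m∸n+n≡m (<⇒≤ (toℕ<n y))) ⟩
    toℕ x + m                        ≈⟨ +-m (toℕ x) ⟩
    toℕ x                            ∎
    where open ≈-Reasoning

  Invertible⇒unit : ∀ d → Invertible m d → ∃ λ e → toℕ d * e ≈ 1
  Invertible⇒unit d (e , de≡1) =
    toℕ e , ≈-trans (≈-sym (toℕ-[] _)) (≈-trans (≡⇒≈ (cong toℕ de≡1)) (toℕ-[] 1))

  -- The row and triangle counters behind `multiplicity` are private to Defs. These metavariables
  -- are solved by unification with the unfoldings of `multiplicity` in `unfoldRows` and
  -- `unfoldRow`, so they are definitionally those counters.
  mutual
    countRow countRows : (a d₁ d₂ x : Fin m) → ℕ → ℕ → ℕ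
    countRow  = _
    countRows = _

    private
      unfoldRows : ∀ a d₁ d₂ x n → multiplicity m a d₁ d₂ (suc n) x ≡ multiplicity m a d₁ d₂ (suc n) x
      unfoldRows a d₁ d₂ x n with suc n
      ... | w with w ∸ n
      ... | zero  = refl {x = countRows a d₁ d₂ x w n}
      ... | suc _ = refl

      unfoldRow : ∀ a d₁ d₂ x n → multiplicity m a d₁ d₂ (suc n) x ≡ multiplicity m a d₁ d₂ (suc n) x
      unfoldRow a d₁ d₂ x n with suc n
      ... | w with w ∸ n
      ... | r = refl {x = countRow a d₁ d₂ x n r + countRows a d₁ d₂ x w n}

  module _ (a d₁ d₂ x : Fin m) where

    private
      A D₁ D₂ X c : ℕ
      A  = toℕ a
      D₁ = toℕ d₁
      D₂ = toℕ d₂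
      X  = toℕ x
      c  = A + - X

    ATentry≡⇔ : ∀ i j → ATentry m a d₁ d₂ i j ≡ x ⇔ c + i * D₂ + j * D₁ ≈ 0
    ATentry≡⇔ i j = mk⇔
      (λ entry≡x → ≈-trans (≡⇒≈ (sym regroup)) (Equivalence.to (≈⇔-≈0 E X)
        (≈-trans (≈-sym (toℕ-ATentry a d₁ d₂ i j)) (≡⇒≈ (cong toℕ entry≡x)))))
      (λ c+…≈0 → toℕ-≈⇒≡ _ x (≈-trans (toℕ-ATentry a d₁ d₂ i j)
        (Equivalence.from (≈⇔-≈0 E X) (≈-trans (≡⇒≈ regroup) c+…≈0))))
      where
      E : ℕ
      E = A + i * D₂ + j * D₁
      regroup : E + - X ≡ c + i * D₂ + j * D₁
      regroup = rearrange A (- X) (i * D₂) (j * D₁)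
        where
        rearrange : ∀ a b c d → a + c + d + b ≡ a + b + c + d
        rearrange = solve-∀

    countRow≡ : ∀ i r → countRow a d₁ d₂ x i r ≡ ∑[ j < r ] χ (c + i * D₂ + j * D₁)
    countRow≡ i zero    = refl
    countRow≡ i (suc r) = cong₂ _+_ (𝟙-⇔ (ATentry≡⇔ i r) _ _) (countRow≡ i r)

    countRows≡ : ∀ w k → countRows a d₁ d₂ x w k ≡ ∑[ i < k ] ∑[ j < w ∸ i ] χ (c + i * D₂ + j * D₁)
    countRows≡ w zero    = refl
    countRows≡ w (suc k) = cong₂ _+_ (countRow≡ k (w ∸ k)) (countRows≡ w k)

    multiplicity≡zeroCount : ∀ n → multiplicity m a d₁ d₂ n x ≡ zeroCount D₁ D₂ n c
    multiplicity≡zeroCount n = countRows≡ n n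

  balanced : ∀ a d₁ d₂ → Invertible m d₁ → Invertible m d₂ → Invertible m (_⊝_ m d₂ d₁) →
    ∀ n → n % m ≡ 0 ⊎ (n + 1) % m ≡ 0 → Balanced m (multiplicity m a d₁ d₂ n)
  balanced a d₁ d₂ d₁-inv d₂-inv d₂-d₁-inv n n≡0∨-1 x y = begin
    multiplicity m a d₁ d₂ n x   ≡⟨ multiplicity≡zeroCount a d₁ d₂ x n ⟩
    count (toℕ a + - toℕ x)      ≡⟨ count-constant (toℕ a + - toℕ x) (toℕ a + - toℕ y) ⟩
    count (toℕ a + - toℕ y)      ≡⟨ multiplicity≡zeroCount a d₁ d₂ y n ⟨
    multiplicity m a d₁ d₂ n y   ∎
    where
    open ≡-Reasoning
    count : ℕ → ℕ
    count = zeroCount (toℕ d₁) (toℕ d₂) n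

    count-+D₁ : ∀ c → count (c + toℕ d₁) ≡ count c
    count-+D₁ c = zeroCount-+D₁ (toℕ d₁) (toℕ d₂) n c (column≡hypotenuse (toℕ-⊝ d₂ d₁)
      (proj₂ (Invertible⇒unit d₂ d₂-inv)) (proj₂ (Invertible⇒unit (_⊝_ m d₂ d₁) d₂-d₁-inv)) n n≡0∨-1 c)

    count-constant : ∀ c c' → count c ≡ count c'
    count-constant = translation-invariant⇒constant count (proj₂ (Invertible⇒unit d₁ d₁-inv))
      (zeroCount-cong (toℕ d₁) (toℕ d₂) n) count-+D₁

theorem14 : (k : ℕ) → let m = suc (2 * k) in
    (a d₁ d₂ : Fin m) →
    Invertible m d₁ → Invertible m d₂ → Invertible m (_⊝_ m d₂ d₁) →
    (n : ℕ) → (n % m ≡ 0 ⊎ (n + 1) % m ≡ 0) →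
    Balanced m (multiplicity m a d₁ d₂ n)
theorem14 k = Modulo.balanced (suc (2 * k))
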